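{- Let $H$ be a finite simple graph and $k\ge 2$, and assume $\Delta_k^t(H)$ is not the void complex. Then for every clique $N\subseteq V(H)$, $\Delta^t_k (H) \subseteq \mathrm{st}_{\Delta^t_{k-1}(H)} N$.
   Context: For $j\ge 1$, $\Delta_j^t(H)$ is the simplicial complex on $V(H)$ whose facets are the complements $V(H)\setminus S$ of independent sets $S$ of size $j$; it is the void complex (no faces) if there are none. For a complex $\Delta$ and a set $\sigma$, $\mathrm{st}_\Delta\sigma=\{\tau\in\Delta:\sigma\cup\tau\in\Delta\}$. -}

module Defs where

open import Data.Nat using (ℕ; _∸_)
open import Data.Fin using (Fin)
open import Data.Fin.Subset using (Subset; _∈_; _⊆_; ∁; _∪_; ∣_∣)
open import Data.Product using (Σ; _×_; ∃)
open import Relation.Binary.PropositionalEquality using (_≡_)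
open import Relation.Nullary using (¬_)
open import Level using (0ℓ; suc)

record SimpleGraph (n : ℕ) : Set₁ where
  field
    Adj       : Fin n → Fin n → Set
    sym       : ∀ {u v} → Adj u v → Adj v u
    irrefl    : ∀ {v} → ¬ Adj v v

open SimpleGraph public

IsIndependent : ∀ {n} → SimpleGraph n → Subset n → Set
IsIndependent H S = ∀ {u v} → u ∈ S → v ∈ S → ¬ Adj H u v

IsClique : ∀ {n} → SimpleGraph n → Subset n → Set
IsClique H N = ∀ {u v} → u ∈ N → v ∈ N → ¬ (u ≡ v) → Adj H u v

Complex : ℕ → Set₁
Complex n = Subset n → Set

-- Δ_j^t(H): facets are complements V(H) \ S of independent sets S with |S| = j;
-- faces are subsets of facets.  If no such S exists, no face exists (void complex).
Δt : ∀ {n} → ℕ → SimpleGraph n → Complex n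
Δt j H σ = Σ _ λ S → IsIndependent H S × ∣ S ∣ ≡ j × σ ⊆ ∁ S

NonVoid : ∀ {n} → Complex n → Set
NonVoid Δ = ∃ λ σ → Δ σ

Star : ∀ {n} → Complex n → Subset n → Complex n
Star Δ σ τ = Δ τ × Δ (σ ∪ τ)

_⊆ᶜ_ : ∀ {n} → Complex n → Complex n → Set
Δ ⊆ᶜ Δ' = ∀ σ → Δ σ → Δ' σ

{-# OPTIONS --safe #-}
-- An independent set S meets a clique N in at most one vertex.  So if σ avoids an
-- independent k-set S, deleting from S one vertex x that covers S ∩ N leaves an
-- independent (k−1)-set S - x avoided by σ and by N, i.e. both σ and N ∪ σ lie in
-- the facet V ∖ (S - x) of Δ_{k−1}^t.
module Submission where

open import Defs
open import Data.Nat using (ℕ; zero; suc; _≥_; _∸_)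
open import Data.Nat.Properties using (suc-injective)
open import Data.Fin using (Fin; zero; suc; _≟_)
open import Data.Fin.Subset
  using (Subset; inside; outside; _∈_; _∉_; _⊆_; ∁; _∪_; _∩_; _─_; _-_; ⁅_⁆; ∣_∣; Nonempty)
open import Data.Fin.Subset.Properties
  using (nonempty?; x∈p∩q⁺; x∈p∩q⁻; x∈p∪q⁻; x∉p⇒x∈∁p; p⊆q⇒∁p⊇∁q; p─q⊆p; p─⊥≡p; x∈⁅x⁆)
open import Data.Vec using (_∷_)
open import Data.Vec.Base using (here; there)
open import Data.Product using (∃; _×_; _,_; proj₁)
open import Data.Sum using ([_,_])
open import Data.Empty using (⊥-elim)
open import Relation.Nullary using (yes; no)
open import Relation.Binary.PropositionalEquality using (_≡_; cong; trans; subst)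

x∈p─q⇒x∉q : ∀ {n} {x : Fin n} (p q : Subset n) → x ∈ p ─ q → x ∉ q
x∈p─q⇒x∉q (inside ∷ p) (outside ∷ q) here        ()
x∈p─q⇒x∉q (_      ∷ p) (_       ∷ q) (there x∈) (there x∈q) = x∈p─q⇒x∉q p q x∈ x∈q

x∈p⇒suc∣p-x∣≡∣p∣ : ∀ {n} {x : Fin n} {p : Subset n} → x ∈ p → suc ∣ p - x ∣ ≡ ∣ p ∣
x∈p⇒suc∣p-x∣≡∣p∣ {x = zero}  {inside  ∷ p} here        = cong (λ q → suc ∣ q ∣) (p─⊥≡p p)
x∈p⇒suc∣p-x∣≡∣p∣ {x = suc x} {outside ∷ p} (there x∈p) = x∈p⇒suc∣p-x∣≡∣p∣ x∈p
x∈p⇒suc∣p-x∣≡∣p∣ {x = suc x} {inside  ∷ p} (there x∈p) = cong suc (x∈p⇒suc∣p-x∣≡∣p∣ x∈p)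

∣p∣≡suc⇒Nonempty : ∀ {n j} (p : Subset n) → ∣ p ∣ ≡ suc j → Nonempty p
∣p∣≡suc⇒Nonempty (inside  ∷ p) _ = zero , here
∣p∣≡suc⇒Nonempty (outside ∷ p) e with ∣p∣≡suc⇒Nonempty p e
... | x , x∈p = suc x , there x∈p

module _ {n} (H : SimpleGraph n) where

  independent-⊆ : ∀ {S T} → IsIndependent H S → T ⊆ S → IsIndependent H T
  independent-⊆ ind T⊆S u∈T v∈T = ind (T⊆S u∈T) (T⊆S v∈T)

  independent∩clique-unique : ∀ {S N u v} → IsIndependent H S → IsClique H N →
    u ∈ S → u ∈ N → v ∈ S → v ∈ N → u ≡ v
  independent∩clique-unique {u = u} {v} ind cl u∈S u∈N v∈S v∈N with u ≟ v
  ... | yes u≡v = u≡v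
  ... | no  u≢v = ⊥-elim (ind u∈S v∈S (cl u∈N v∈N u≢v))

  independent∩clique⊆⁅x⁆ : ∀ {S N x} → IsIndependent H S → IsClique H N →
    x ∈ S ∩ N → S ∩ N ⊆ ⁅ x ⁆
  independent∩clique⊆⁅x⁆ {S} {N} {x} ind cl x∈S∩N {y} y∈S∩N
    with x∈p∩q⁻ S N x∈S∩N | x∈p∩q⁻ S N y∈S∩N
  ... | x∈S , x∈N | y∈S , y∈N =
    subst (_∈ ⁅ x ⁆) (independent∩clique-unique ind cl x∈S x∈N y∈S y∈N) (x∈⁅x⁆ x)

  ∃-independent∩clique⊆⁅x⁆ : ∀ {S N} → IsIndependent H S → IsClique H N →
    Nonempty S → ∃ λ x → x ∈ S × S ∩ N ⊆ ⁅ x ⁆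
  ∃-independent∩clique⊆⁅x⁆ {S} {N} ind cl (s , s∈S) with nonempty? (S ∩ N)
  ... | yes (x , x∈S∩N) = x , proj₁ (x∈p∩q⁻ S N x∈S∩N) , independent∩clique⊆⁅x⁆ ind cl x∈S∩N
  ... | no  S∩N-empty   = s , s∈S , λ {y} y∈S∩N → ⊥-elim (S∩N-empty (y , y∈S∩N))

  Δt-suc⊆Star : ∀ j N → IsClique H N → Δt (suc j) H ⊆ᶜ Star (Δt j H) N
  Δt-suc⊆Star j N cl σ (S , ind , ∣S∣≡1+j , σ⊆∁S)
    with ∃-independent∩clique⊆⁅x⁆ ind cl (∣p∣≡suc⇒Nonempty S ∣S∣≡1+j)
  ... | x , x∈S , S∩N⊆⁅x⁆ =
    (S - x , ind′ , ∣S-x∣≡j , σ⊆∁S-x) , (S - x , ind′ , ∣S-x∣≡j , N∪σ⊆∁S-x)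
    where
    ind′ : IsIndependent H (S - x)
    ind′ = independent-⊆ ind (p─q⊆p S ⁅ x ⁆)

    ∣S-x∣≡j : ∣ S - x ∣ ≡ j
    ∣S-x∣≡j = suc-injective (trans (x∈p⇒suc∣p-x∣≡∣p∣ x∈S) ∣S∣≡1+j)

    σ⊆∁S-x : σ ⊆ ∁ (S - x)
    σ⊆∁S-x y∈σ = p⊆q⇒∁p⊇∁q (p─q⊆p S ⁅ x ⁆) (σ⊆∁S y∈σ)

    N⊆∁S-x : N ⊆ ∁ (S - x)
    N⊆∁S-x y∈N = x∉p⇒x∈∁p λ y∈S-x →
      x∈p─q⇒x∉q S ⁅ x ⁆ y∈S-x (S∩N⊆⁅x⁆ (x∈p∩q⁺ (p─q⊆p S ⁅ x ⁆ y∈S-x , y∈N)))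

    N∪σ⊆∁S-x : N ∪ σ ⊆ ∁ (S - x)
    N∪σ⊆∁S-x y∈N∪σ = [ N⊆∁S-x , σ⊆∁S-x ] (x∈p∪q⁻ N σ y∈N∪σ)

proposition3p10 : (n : ℕ) (H : SimpleGraph n) (k : ℕ) → k ≥ 2 →
    NonVoid (Δt k H) →
    (N : Subset n) → IsClique H N →
    Δt k H ⊆ᶜ Star (Δt (k ∸ 1) H) N
proposition3p10 n H (suc k) _ _ N cl = Δt-suc⊆Star H k N cl
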